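{- Let $G$ be a 2-connected outerplanar near-triangulation with $V(G)=\{u,v_1,\dots,v_{2k-1}\}$, $k>1$, $N_G(u)=\{v_1,\dots,v_{2k-1}\}$, $\deg_G(v_1)=\deg_G(v_{2k-1})=2$, and $v_1,\dots,v_{2k-1}$ ordered counter-clockwise (consecutively along the outer cycle). Then $P(G)$ contains a non-vanishing monomial $\eta\,u^3v_1^0v_{2k-1}^0\prod_{i=2}^{2k-2}v_i^2$. Moreover, for $l$ with $2\le l\le 2k-2$, the monomial $\eta_l\,u^4v_1^0v_{2k-1}^0v_l^1\prod_{i\notin\{1,2k-1,l\}}v_i^2$ does not vanish for every odd $l$ with $3\le l<2k-1$ and vanishes for every even $l$ with $2\le l<2k$; and $|\eta|=|\eta_l|=1$ (for the non-vanishing ones).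
   Context: For a graph $G$, vertices are also variables and $P(G)=\prod_{xy\in E(G),\,x<y}(x-y)$ for a fixed arbitrary orientation; a monomial is non-vanishing if its coefficient is nonzero and vanishes otherwise. A 2-connected outerplanar near-triangulation is a 2-connected outerplanar graph embedded with all vertices on the outer cycle and all bounded faces triangles. -}

module Defs where

open import Data.Nat using (ℕ; zero; suc; _+_; _*_; _∸_; _≤_; _<_; _≡ᵇ_; _<ᵇ_)
open import Data.Fin using (Fin; toℕ)
open import Data.Bool using (Bool; true; false; if_then_else_; _∧_; _∨_)
open import Data.List using (List; []; _∷_; concatMap; allFin; map)
open import Data.Bool.ListAction using (and)
open import Data.Nat.ListAction using (sum)
open import Data.Integer using (ℤ; _-_) renaming (+_ to ℤ+)
open import Data.Product using (_×_; _,_; ∃-syntax)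
open import Relation.Binary.PropositionalEquality using (_≡_; _≢_)

Graph : ℕ → Set
Graph n = Fin n → Fin n → Bool

degree : ∀ {n} → Graph n → Fin n → ℕ
degree {n} G i = sum (map (λ j → if G i j then 1 else 0) (allFin n))

data WalkAvoiding {n} (G : Graph n) (w : Fin n) : Fin n → Fin n → Set where
  here : ∀ {x} → WalkAvoiding G w x x
  step : ∀ {x y z} → G x y ≡ true → y ≢ w → WalkAvoiding G w y z → WalkAvoiding G w x z

TwoConnected : ∀ {n} → Graph n → Set
TwoConnected {n} G = (3 ≤ n) × (∀ w x y → x ≢ w → y ≢ w → WalkAvoiding G w x y)

-- Outerplanar near-triangulation, embedded so that the outer cycle is
-- 0, 1, ..., n-1 (in this cyclic order).  Chords are non-crossing, and every
-- bounded face is a triangle: for every edge ab (a < b, b ≥ a+2) the face on the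
-- side of ab containing a+1,...,b-1 is a triangle abc.
record OuterplanarNearTriangulation {n} (G : Graph n) : Set where
  field
    three≤n     : 3 ≤ n
    symmetric   : ∀ i j → G i j ≡ G j i
    irreflexive : ∀ i → G i i ≡ false
    cycleEdge   : ∀ i j → toℕ j ≡ suc (toℕ i) → G i j ≡ true
    closingEdge : ∀ i j → toℕ i ≡ 0 → suc (toℕ j) ≡ n → G i j ≡ true
    noncrossing : ∀ a b c d → toℕ a < toℕ b → toℕ b < toℕ c → toℕ c < toℕ d →
                  G a c ≡ true → G b d ≡ false
    triangular  : ∀ a b → toℕ a + 2 ≤ toℕ b → G a b ≡ true →
                  ∃[ c ] (toℕ a < toℕ c × toℕ c < toℕ b × G a c ≡ true × G c b ≡ true)

Monomial : ℕ → Set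
Monomial n = Fin n → ℕ

-- d - e_a  (only used when d a ≥ 1)
lower : ∀ {n} → Fin n → Monomial n → Monomial n
lower a d x = if toℕ x ≡ᵇ toℕ a then d x ∸ 1 else d x

-- coefficient of x^d in the product  ∏_{(a,b) ∈ es} (x_a - x_b)
coeffProd : ∀ {n} → List (Fin n × Fin n) → Monomial n → ℤ
coeffProd {n} [] d = if and (map (λ x → d x ≡ᵇ 0) (allFin n)) then ℤ+ 1 else ℤ+ 0
coeffProd ((a , b) ∷ es) d = term a - term b
  where
  term : _ → ℤ
  term c = if d c ≡ᵇ 0 then ℤ+ 0 else coeffProd es (lower c d)

edges : ∀ {n} → Graph n → List (Fin n × Fin n)
edges {n} G = concatMap (λ i → concatMap
  (λ j → if (toℕ i <ᵇ toℕ j) ∧ G i j then (i , j) ∷ [] else []) (allFin n)) (allFin n)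

-- coefficient of x^d in P(G) = ∏_{xy ∈ E(G), x<y} (x - y)
coeffP : ∀ {n} → Graph n → Monomial n → ℤ
coeffP G d = coeffProd (edges G) d

-- vertices: u = 0, v_i = i (1 ≤ i ≤ 2k-1)
-- η-monomial: u^3 v_1^0 v_{2k-1}^0 ∏_{i=2}^{2k-2} v_i^2
etaMono : (k : ℕ) → Monomial (2 * k)
etaMono k x = if toℕ x ≡ᵇ 0 then 3
  else if (toℕ x ≡ᵇ 1) ∨ (toℕ x ≡ᵇ (2 * k ∸ 1)) then 0 else 2

etaLMono : (k l : ℕ) → Monomial (2 * k)
etaLMono k l x = if toℕ x ≡ᵇ 0 then 4
  else if (toℕ x ≡ᵇ 1) ∨ (toℕ x ≡ᵇ (2 * k ∸ 1)) then 0
  else if toℕ x ≡ᵇ l then 1 else 2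

-- Because u is adjacent to every other vertex and chords of an outerplanar embedding do not
-- cross, G is the fan formed by the spokes u v_i and the path v_1 v_2 ⋯ v_{2k−1}. The coefficient
-- of a monomial in a product of linear factors does not depend on the order of the factors, so
-- they may be multiplied as (u − v_1)(v_1 − v_2)(u − v_2)(v_2 − v_3) ⋯ (u − v_{2k−1}). After the
-- factor (v_i − v_{i+1}) the variable v_i never occurs again, so the coefficient obeys a transfer
-- recursion in the remaining exponents of u and of the current path vertex. Along the exponent
-- patterns 2, …, 2, 0 (for η) and 2, …, 2, 1, 2, …, 2, 0 (for η_l) this recursion has period 2,
-- and evaluating it gives ±1 or 0 according to parity.
module Submission where

open import Defs
open import Data.Bool using (Bool; true; false; if_then_else_; _∧_; _∨_; not; _xor_; T)
open import Data.Bool.ListAction using (and)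
open import Data.Bool.Properties using (T-≡; not-distribˡ-xor; xor-same; not-involutive; not-injective)
open import Data.Empty using (⊥-elim)
open import Data.Fin using (Fin; toℕ; fromℕ<)
import Data.Fin as Fin
open import Data.Fin.Properties using (toℕ-fromℕ<; toℕ<n)
open import Data.Integer using (ℤ; _-_; 0ℤ; 1ℤ; -1ℤ; ∣_∣) renaming (+_ to ℤ+)
open import Data.Integer.Tactic.RingSolver using (solve-∀)
open import Data.List using (List; []; _∷_; _++_; map; concatMap; allFin; replicate; tabulate)
open import Data.List.Membership.Propositional using (_∈_)
open import Data.List.Membership.Propositional.Properties using (∈-allFin)
open import Data.List.Properties using (++-identityʳ; map-cong; map-concatMap; concatMap-map; concatMap-cong)
open import Data.List.Relation.Binary.Permutation.Propositional using (_↭_; refl; prep; swap; trans)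
open import Data.List.Relation.Binary.Permutation.Propositional.Properties using (shift)
open import Data.List.Relation.Unary.All using (All; []; _∷_)
open import Data.List.Relation.Unary.Any using (here; there)
open import Data.Nat using (ℕ; zero; suc; _+_; _*_; _∸_; _≤_; _<_; _≡ᵇ_; _<ᵇ_; z≤n; s≤s; z<s; _≟_)
open import Data.Nat.Properties
open import Data.Product using (_×_; _,_; proj₂; ∃-syntax)
open import Data.Sum using (_⊎_; inj₁; inj₂)
open import Data.Unit using (tt)
open import Function using (_∘_)
open import Function.Bundles using (_⇔_; Equivalence)
open import Relation.Binary using (tri<; tri≈; tri>)
open import Relation.Binary.PropositionalEquality
  using (_≡_; _≢_; refl; sym; cong; cong₂; subst; module ≡-Reasoning)
  renaming (trans to ≡-trans)
open import Relation.Nullary using (yes; no)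

≡ᵇ-refl : ∀ n → (n ≡ᵇ n) ≡ true
≡ᵇ-refl zero    = refl
≡ᵇ-refl (suc n) = ≡ᵇ-refl n

≢⇒≡ᵇ≡false : ∀ {m n} → m ≢ n → (m ≡ᵇ n) ≡ false
≢⇒≡ᵇ≡false {m} {n} m≢n with m ≡ᵇ n in eq
... | true  = ⊥-elim (m≢n (≡ᵇ⇒≡ m n (subst T (sym eq) tt)))
... | false = refl

xor≡false⇒≡ : ∀ {x y} → x xor y ≡ false → x ≡ y
xor≡false⇒≡ {true}  {true}  _ = refl
xor≡false⇒≡ {false} {false} _ = refl

and-map-false : ∀ {A : Set} (f : A → Bool) {xs y} → y ∈ xs → f y ≡ false → and (map f xs) ≡ false
and-map-false f {x ∷ xs} (here refl) fy≡false rewrite fy≡false = refl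
and-map-false f {x ∷ xs} (there y∈xs) fy≡false with f x
... | true  = and-map-false f y∈xs fy≡false
... | false = refl

and-map-true : ∀ {A : Set} (f : A → Bool) xs → (∀ y → f y ≡ true) → and (map f xs) ≡ true
and-map-true f []       f≡true = refl
and-map-true f (x ∷ xs) f≡true rewrite f≡true x = and-map-true f xs f≡true

odd : ℕ → Bool
odd zero    = false
odd (suc n) = not (odd n)

odd-+ : ∀ m n → odd (m + n) ≡ odd m xor odd n
odd-+ zero    n = refl
odd-+ (suc m) n rewrite odd-+ m n = not-distribˡ-xor (odd m) (odd n)

odd-2* : ∀ j → odd (2 * j) ≡ false
odd-2* j rewrite odd-+ j (j + 0) | +-identityʳ j = xor-same (odd j)

odd-2*+1 : ∀ j → odd (2 * j + 1) ≡ true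
odd-2*+1 j rewrite odd-+ (2 * j) 1 | odd-2* j = refl

range : ℕ → ℕ → List ℕ
range a zero    = []
range a (suc m) = a ∷ range (suc a) m

map-range-cong : ∀ {A : Set} {f g : ℕ → A} a m → (∀ x → a ≤ x → f x ≡ g x) →
  map f (range a m) ≡ map g (range a m)
map-range-cong a zero    f≗g = refl
map-range-cong a (suc m) f≗g =
  cong₂ _∷_ (f≗g a ≤-refl) (map-range-cong (suc a) m (λ x a<x → f≗g x (<⇒≤ a<x)))

map-toℕ-tabulate : ∀ {n} m a (f : Fin m → Fin n) → (∀ i → toℕ (f i) ≡ a + toℕ i) →
  map toℕ (tabulate f) ≡ range a m
map-toℕ-tabulate zero    a f f≡a+ = refl
map-toℕ-tabulate (suc m) a f f≡a+ =
  cong₂ _∷_ (≡-trans (f≡a+ Fin.zero) (+-identityʳ a))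
            (map-toℕ-tabulate m (suc a) (f ∘ Fin.suc)
              (λ i → ≡-trans (f≡a+ (Fin.suc i)) (+-suc a (toℕ i))))

map-toℕ-allFin : ∀ n → map toℕ (allFin n) ≡ range 0 n
map-toℕ-allFin n = map-toℕ-tabulate n 0 (λ i → i) (λ i → refl)

concatMap-range-outside : ∀ {B : Set} {f : ℕ → List B} {c} a m → (∀ x → x ≢ c → f x ≡ []) →
  c < a ⊎ a + m ≤ c → concatMap f (range a m) ≡ []
concatMap-range-outside a zero    f≡[] out = refl
concatMap-range-outside a (suc m) f≡[] (inj₁ c<a) =
  cong₂ _++_ (f≡[] a (>⇒≢ c<a)) (concatMap-range-outside (suc a) m f≡[] (inj₁ (m<n⇒m<1+n c<a)))
concatMap-range-outside {c = c} a (suc m) f≡[] (inj₂ a+1+m≤c) =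
  cong₂ _++_ (f≡[] a (<⇒≢ (<-≤-trans (m<m+n a z<s) a+1+m≤c)))
             (concatMap-range-outside (suc a) m f≡[] (inj₂ (subst (_≤ c) (+-suc a m) a+1+m≤c)))

concatMap-range-inside : ∀ {B : Set} {f : ℕ → List B} {c} a m → (∀ x → x ≢ c → f x ≡ []) →
  a ≤ c → c < a + m → concatMap f (range a m) ≡ f c
concatMap-range-inside a zero f≡[] a≤c c<a+0 =
  ⊥-elim (<⇒≱ (subst (_ <_) (+-identityʳ a) c<a+0) a≤c)
concatMap-range-inside {f = f} {c} a (suc m) f≡[] a≤c c<a+1+m with a ≟ c
... | yes refl = ≡-trans (cong (f a ++_) (concatMap-range-outside (suc a) m f≡[] (inj₁ (n<1+n a))))
                         (++-identityʳ (f a))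
... | no a≢c   = cong₂ _++_ (f≡[] a a≢c)
                   (concatMap-range-inside (suc a) m f≡[] (≤∧≢⇒< a≤c a≢c)
                      (subst (c <_) (+-suc a m) c<a+1+m))

map-concatMap-allFin : ∀ {A B : Set} {n} (f : A → B) (g : Fin n → List A) (h : ℕ → List B) →
  (∀ i → map f (g i) ≡ h (toℕ i)) → map f (concatMap g (allFin n)) ≡ concatMap h (range 0 n)
map-concatMap-allFin {n = n} f g h f∘g≗h∘toℕ = begin
  map f (concatMap g (allFin n))     ≡⟨ map-concatMap f g (allFin n) ⟩
  concatMap (map f ∘ g) (allFin n)   ≡⟨ concatMap-cong f∘g≗h∘toℕ (allFin n) ⟩
  concatMap (h ∘ toℕ) (allFin n)     ≡⟨ concatMap-map h toℕ (allFin n) ⟨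
  concatMap h (map toℕ (allFin n))   ≡⟨ cong (concatMap h) (map-toℕ-allFin n) ⟩
  concatMap h (range 0 n)            ∎
  where open ≡-Reasoning

-- Coefficients of products of linear forms

-- Exponent vectors indexed by ℕ rather than Fin n, so that vertex arithmetic
-- (J, J + 1, …) needs no bound proofs.
Exponents : Set
Exponents = ℕ → ℕ

lowerAt : ℕ → Exponents → Exponents
lowerAt c D y = if y ≡ᵇ c then D y ∸ 1 else D y

-- coeffProd on ℕ-indexed exponents: the constant term only inspects the variables below n.
mutual
  coeff : ℕ → List (ℕ × ℕ) → Exponents → ℤ
  coeff n []             D = if and (map (λ x → D (toℕ x) ≡ᵇ 0) (allFin n)) then 1ℤ else 0ℤ
  coeff n ((a , b) ∷ es) D = coeffPicking n es a D - coeffPicking n es b D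

  coeffPicking : ℕ → List (ℕ × ℕ) → ℕ → Exponents → ℤ
  coeffPicking n es c D = if D c ≡ᵇ 0 then 0ℤ else coeff n es (lowerAt c D)

toℕ² : ∀ {n} → Fin n × Fin n → ℕ × ℕ
toℕ² (a , b) = toℕ a , toℕ b

coeffProd≡coeff : ∀ {n} (es : List (Fin n × Fin n)) (D : Exponents) →
  coeffProd es (D ∘ toℕ) ≡ coeff n (map toℕ² es) D
coeffProd≡coeff []             D = refl
coeffProd≡coeff ((a , b) ∷ es) D = cong₂ _-_ (picking a) (picking b)
  where
  picking : ∀ c → (if D (toℕ c) ≡ᵇ 0 then 0ℤ else coeffProd es (lower c (D ∘ toℕ)))
                  ≡ coeffPicking _ (map toℕ² es) (toℕ c) D
  picking c with D (toℕ c) ≡ᵇ 0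
  ... | true  = refl
  ... | false = coeffProd≡coeff es (lowerAt (toℕ c) D)

lowerAt-cong : ∀ c {D D′ : Exponents} → (∀ x → D x ≡ D′ x) → ∀ x → lowerAt c D x ≡ lowerAt c D′ x
lowerAt-cong c D≗D′ x with x ≡ᵇ c
... | true  = cong (_∸ 1) (D≗D′ x)
... | false = D≗D′ x

lowerAt-other : ∀ {c x} D → x ≢ c → lowerAt c D x ≡ D x
lowerAt-other D x≢c rewrite ≢⇒≡ᵇ≡false x≢c = refl

lowerAt-same : ∀ c D → lowerAt c D c ≡ D c ∸ 1
lowerAt-same c D rewrite ≡ᵇ-refl c = refl

lowerAt-zero : ∀ c D x → D x ≡ 0 → lowerAt c D x ≡ 0
lowerAt-zero c D x Dx≡0 with x ≡ᵇ c
... | true  = cong (_∸ 1) Dx≡0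
... | false = Dx≡0

lowerAt-comm : ∀ x y D z → lowerAt y (lowerAt x D) z ≡ lowerAt x (lowerAt y D) z
lowerAt-comm x y D z with z ≡ᵇ y | z ≡ᵇ x
... | true  | true  = refl
... | true  | false = refl
... | false | true  = refl
... | false | false = refl

map-lowerAt-range : ∀ {c} D a m → c < a → map (lowerAt c D) (range a m) ≡ map D (range a m)
map-lowerAt-range D a m c<a =
  map-range-cong a m (λ x a≤x → lowerAt-other D (>⇒≢ (<-≤-trans c<a a≤x)))

coeff-cong : ∀ n es {D D′ : Exponents} → (∀ x → D x ≡ D′ x) → coeff n es D ≡ coeff n es D′
coeff-cong n [] D≗D′ =
  cong (if_then 1ℤ else 0ℤ) (cong and (map-cong (λ x → cong (_≡ᵇ 0) (D≗D′ (toℕ x))) (allFin n)))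
coeff-cong n ((a , b) ∷ es) {D} {D′} D≗D′ = cong₂ _-_ (picking a) (picking b)
  where
  picking : ∀ c → coeffPicking n es c D ≡ coeffPicking n es c D′
  picking c rewrite D≗D′ c with D′ c ≡ᵇ 0
  ... | true  = refl
  ... | false = coeff-cong n es (lowerAt-cong c D≗D′)

coeffPicking₂ : ℕ → List (ℕ × ℕ) → ℕ → ℕ → Exponents → ℤ
coeffPicking₂ n es x y D = if D x ≡ᵇ 0 then 0ℤ else coeffPicking n es y (lowerAt x D)

coeffPicking₂-comm : ∀ n es x y D → coeffPicking₂ n es x y D ≡ coeffPicking₂ n es y x D
coeffPicking₂-comm n es x y D with x ≟ y
... | yes refl = refl
... | no x≢y rewrite lowerAt-other D (x≢y ∘ sym) | lowerAt-other D x≢y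
  with D x ≡ᵇ 0 | D y ≡ᵇ 0
... | true  | true  = refl
... | true  | false = refl
... | false | true  = refl
... | false | false = coeff-cong n es (lowerAt-comm x y D)

coeffPicking-∷ : ∀ n es a b c D →
  coeffPicking n ((a , b) ∷ es) c D ≡ coeffPicking₂ n es c a D - coeffPicking₂ n es c b D
coeffPicking-∷ n es a b c D with D c ≡ᵇ 0
... | true  = refl
... | false = refl

coeff-swap : ∀ n es p q D → coeff n (p ∷ q ∷ es) D ≡ coeff n (q ∷ p ∷ es) D
coeff-swap n es (a , b) (c , e) D = begin
  coeffPicking n ((c , e) ∷ es) a D - coeffPicking n ((c , e) ∷ es) b D
    ≡⟨ cong₂ _-_ (coeffPicking-∷ n es c e a D) (coeffPicking-∷ n es c e b D) ⟩
  (P a c - P a e) - (P b c - P b e)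
    ≡⟨ exchange (P a c) (P a e) (P b c) (P b e) ⟩
  (P a c - P b c) - (P a e - P b e)
    ≡⟨ cong₂ _-_ (cong₂ _-_ (comm a c) (comm b c)) (cong₂ _-_ (comm a e) (comm b e)) ⟩
  (P c a - P c b) - (P e a - P e b)
    ≡⟨ sym (cong₂ _-_ (coeffPicking-∷ n es a b c D) (coeffPicking-∷ n es a b e D)) ⟩
  coeffPicking n ((a , b) ∷ es) c D - coeffPicking n ((a , b) ∷ es) e D ∎
  where
  open ≡-Reasoning
  P : ℕ → ℕ → ℤ
  P x y = coeffPicking₂ n es x y D
  comm : ∀ x y → P x y ≡ P y x
  comm x y = coeffPicking₂-comm n es x y D
  exchange : ∀ (w x y z : ℤ) → (w - x) - (y - z) ≡ (w - y) - (x - z)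
  exchange = solve-∀

coeff-∷ : ∀ n {es es′} → (∀ D → coeff n es D ≡ coeff n es′ D) →
  ∀ p D → coeff n (p ∷ es) D ≡ coeff n (p ∷ es′) D
coeff-∷ n {es} {es′} es≈es′ (a , b) D = cong₂ _-_ (picking a) (picking b)
  where
  picking : ∀ c → coeffPicking n es c D ≡ coeffPicking n es′ c D
  picking c with D c ≡ᵇ 0
  ... | true  = refl
  ... | false = es≈es′ (lowerAt c D)

coeff-↭ : ∀ n {es es′} → es ↭ es′ → ∀ D → coeff n es D ≡ coeff n es′ D
coeff-↭ n refl D = refl
coeff-↭ n (prep {xs} {ys} p xs↭ys) D = coeff-∷ n {xs} {ys} (coeff-↭ n xs↭ys) p D
coeff-↭ n (swap {xs} {ys} p q xs↭ys) D =
  ≡-trans (coeff-swap n xs p q D)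
          (coeff-∷ n {p ∷ xs} {p ∷ ys} (coeff-∷ n {xs} {ys} (coeff-↭ n xs↭ys) p) q D)
coeff-↭ n (trans xs↭ys ys↭zs) D = ≡-trans (coeff-↭ n xs↭ys D) (coeff-↭ n ys↭zs D)

coeff-[]-nonzero : ∀ n D {x} → x < n → D x ≢ 0 → coeff n [] D ≡ 0ℤ
coeff-[]-nonzero n D x<n Dx≢0
  rewrite and-map-false (λ y → D (toℕ y) ≡ᵇ 0) (∈-allFin (fromℕ< x<n))
            (subst (λ z → (D z ≡ᵇ 0) ≡ false) (sym (toℕ-fromℕ< x<n)) (≢⇒≡ᵇ≡false Dx≢0))
  = refl

coeff-[]-zero : ∀ n D → (∀ x → x < n → D x ≡ 0) → coeff n [] D ≡ 1ℤ
coeff-[]-zero n D D≡0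
  rewrite and-map-true (λ y → D (toℕ y) ≡ᵇ 0) (allFin n)
            (λ y → subst (λ z → (z ≡ᵇ 0) ≡ true) (sym (D≡0 (toℕ y) (toℕ<n y))) refl)
  = refl

_∉ₑ_ : ℕ → ℕ × ℕ → Set
x ∉ₑ (a , b) = a ≢ x × b ≢ x

mutual
  coeff-absent : ∀ n es {x} D → x < n → All (x ∉ₑ_) es → D x ≢ 0 → coeff n es D ≡ 0ℤ
  coeff-absent n []             D x<n []                    Dx≢0 = coeff-[]-nonzero n D x<n Dx≢0
  coeff-absent n ((a , b) ∷ es) D x<n ((a≢x , b≢x) ∷ x∉es) Dx≢0 =
    cong₂ _-_ (coeffPicking-absent n es D x<n x∉es a≢x Dx≢0)
              (coeffPicking-absent n es D x<n x∉es b≢x Dx≢0)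

  coeffPicking-absent : ∀ n es {x c} D → x < n → All (x ∉ₑ_) es → c ≢ x → D x ≢ 0 →
    coeffPicking n es c D ≡ 0ℤ
  coeffPicking-absent n es {c = c} D x<n x∉es c≢x Dx≢0 with D c ≡ᵇ 0
  ... | true  = refl
  ... | false = coeff-absent n es (lowerAt c D) x<n x∉es
                  (Dx≢0 ∘ ≡-trans (sym (lowerAt-other D (c≢x ∘ sym))))

coeffPicking-zero : ∀ n es {c} D → D c ≡ 0 → coeffPicking n es c D ≡ 0ℤ
coeffPicking-zero n es D Dc≡0 rewrite Dc≡0 = refl

coeffPicking-suc : ∀ n es {c a} D → D c ≡ suc a → coeffPicking n es c D ≡ coeff n es (lowerAt c D)
coeffPicking-suc n es D Dc≡suc rewrite Dc≡suc = refl

-- The transfer recursion of a fan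

fanEdges : ℕ → ℕ → List (ℕ × ℕ)
fanEdges j zero    = (0 , j) ∷ []
fanEdges j (suc m) = (0 , j) ∷ (j , suc j) ∷ fanEdges (suc j) m

fanEdges-avoids : ∀ {x} j m → 0 < x → x < j → All (x ∉ₑ_) (fanEdges j m)
fanEdges-avoids j zero    0<x x<j = (<⇒≢ 0<x , >⇒≢ x<j) ∷ []
fanEdges-avoids j (suc m) 0<x x<j =
  (<⇒≢ 0<x , >⇒≢ x<j) ∷ (>⇒≢ x<j , >⇒≢ (<-trans x<j (n<1+n j))) ∷
  fanEdges-avoids (suc j) m 0<x (<-trans x<j (n<1+n j))

whenPositive : ℕ → ℤ → ℤ
whenPositive r z = if r ≡ᵇ 0 then 0ℤ else z

coeffOne : ℕ → ℕ → ℤ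
coeffOne r s = if (r ≡ᵇ 0) ∧ (s ≡ᵇ 0) then 1ℤ else 0ℤ

-- Transfer recursion for the coefficient of u^r v_J^s ∏_i v_{J+1+i}^{cs_i} in the
-- product over fanEdges J (length cs): fanCoeff starts at the spoke (u − v_J), pathCoeff at
-- the path edge (v_J − v_{J+1}), after which v_J no longer occurs.
mutual
  fanCoeff : List ℕ → ℕ → ℕ → ℤ
  fanCoeff []       r s = whenPositive r (coeffOne (r ∸ 1) s) - whenPositive s (coeffOne r (s ∸ 1))
  fanCoeff (c ∷ cs) r s =
    whenPositive r (pathCoeff c cs (r ∸ 1) s) - whenPositive s (pathCoeff c cs r (s ∸ 1))

  pathCoeff : ℕ → List ℕ → ℕ → ℕ → ℤ
  pathCoeff c cs r s = (if s ≡ᵇ 1 then fanCoeff cs r c else 0ℤ)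
                     - (if s ≡ᵇ 0 then whenPositive c (fanCoeff cs r (c ∸ 1)) else 0ℤ)

SupportedOn : ℕ → ℕ → ℕ → Exponents → Set
SupportedOn n J K D = ∀ x → x < n → 0 < x → x < J ⊎ K < x → D x ≡ 0

SupportedOn-lowerAt : ∀ {n J K D} c → SupportedOn n J K D → SupportedOn n J K (lowerAt c D)
SupportedOn-lowerAt {D = D} c supp x x<n 0<x out = lowerAt-zero c D x (supp x x<n 0<x out)

SupportedOn-shift : ∀ {n J K D} → SupportedOn n J K D → D J ≡ 0 → SupportedOn n (suc J) K D
SupportedOn-shift supp DJ≡0 x x<n 0<x (inj₂ K<x) = supp x x<n 0<x (inj₂ K<x)
SupportedOn-shift supp DJ≡0 x x<n 0<x (inj₁ x<1+J) with m<1+n⇒m<n∨m≡n x<1+J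
... | inj₁ x<J  = supp x x<n 0<x (inj₁ x<J)
... | inj₂ refl = DJ≡0

coeff-[]-pair : ∀ n {j} D → 0 < j → j < n → SupportedOn n j j D →
  coeff n [] D ≡ coeffOne (D 0) (D j)
coeff-[]-pair n {j} D 0<j j<n supp with D 0 in D0 | D j in Dj
... | suc _ | _     = coeff-[]-nonzero n D (<-trans 0<j j<n) (λ D0≡0 → 1+n≢0 (≡-trans (sym D0) D0≡0))
... | zero  | suc _ = coeff-[]-nonzero n D j<n (λ Dj≡0 → 1+n≢0 (≡-trans (sym Dj) Dj≡0))
... | zero  | zero  = coeff-[]-zero n D vanishes
  where
  vanishes : ∀ x → x < n → D x ≡ 0
  vanishes zero    x<n = D0
  vanishes (suc x) x<n with <-cmp (suc x) j
  ... | tri< x<j _    _   = supp (suc x) x<n z<s (inj₁ x<j)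
  ... | tri≈ _   refl _   = Dj
  ... | tri> _   _    j<x = supp (suc x) x<n z<s (inj₂ j<x)

FanCoeffFormula : ℕ → ℕ → ℕ → Set
FanCoeffFormula n J m = ∀ D → J + m < n → SupportedOn n J (J + m) D →
  coeff n (fanEdges J m) D ≡ fanCoeff (map D (range (suc J) m)) (D 0) (D J)

coeff-pathEdge : ∀ {n J m} → 0 < J → FanCoeffFormula n (suc J) m →
  ∀ E → suc J + m < n → SupportedOn n J (suc J + m) E →
  coeff n ((J , suc J) ∷ fanEdges (suc J) m) E
    ≡ pathCoeff (E (suc J)) (map E (range (2 + J) m)) (E 0) (E J)
coeff-pathEdge {n} {J} {m} 0<J formula E bound supp = byExponentOfJ (E J) refl
  where
  F : List (ℕ × ℕ)
  F = fanEdges (suc J) m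
  cs : List ℕ
  cs = map E (range (2 + J) m)

  J<n : J < n
  J<n = <-trans (n<1+n J) (≤-<-trans (m≤m+n (suc J) m) bound)

  J∉F : All (J ∉ₑ_) F
  J∉F = fanEdges-avoids (suc J) m 0<J (n<1+n J)

  lowered : ∀ c → 0 ≢ c → c < 2 + J → lowerAt c E J ≡ 0 →
    coeff n F (lowerAt c E) ≡ fanCoeff cs (E 0) (lowerAt c E (suc J))
  lowered c 0≢c c<2+J retired = begin
    coeff n F (lowerAt c E)
      ≡⟨ formula (lowerAt c E) bound (SupportedOn-shift (SupportedOn-lowerAt c supp) retired) ⟩
    fanCoeff (map (lowerAt c E) (range (2 + J) m)) (lowerAt c E 0) (lowerAt c E (suc J))
      ≡⟨ cong₂ (λ ds r → fanCoeff ds r (lowerAt c E (suc J)))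
               (map-lowerAt-range E (2 + J) m c<2+J) (lowerAt-other E 0≢c) ⟩
    fanCoeff cs (E 0) (lowerAt c E (suc J)) ∎
    where open ≡-Reasoning

  -- v_J occurs in no later factor, so the path edge must use up its exponent exactly.
  byExponentOfJ : ∀ e → E J ≡ e →
    coeffPicking n F J E - coeffPicking n F (suc J) E ≡ pathCoeff (E (suc J)) cs (E 0) e
  byExponentOfJ zero EJ≡0 =
    cong₂ _-_ (coeffPicking-zero n F E EJ≡0)
              (cong (whenPositive (E (suc J)))
                    (≡-trans (lowered (suc J) (λ ()) ≤-refl (lowerAt-zero (suc J) E J EJ≡0))
                             (cong (fanCoeff cs (E 0)) (lowerAt-same (suc J) E))))
  byExponentOfJ (suc e) EJ≡1+e =
    cong₂ _-_ (≡-trans (coeffPicking-suc n F E EJ≡1+e) (pickJ e EJ≡1+e)) pickNext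
    where
    pickNext : coeffPicking n F (suc J) E ≡ 0ℤ
    pickNext = coeffPicking-absent n F E J<n J∉F 1+n≢n (λ EJ≡0 → 1+n≢0 (≡-trans (sym EJ≡1+e) EJ≡0))

    pickJ : ∀ e → E J ≡ suc e →
      coeff n F (lowerAt J E) ≡ (if suc e ≡ᵇ 1 then fanCoeff cs (E 0) (E (suc J)) else 0ℤ)
    pickJ zero    EJ≡1 =
      ≡-trans (lowered J (<⇒≢ 0<J) (m≤n⇒m≤1+n (n<1+n J))
                       (≡-trans (lowerAt-same J E) (cong (_∸ 1) EJ≡1)))
              (cong (fanCoeff cs (E 0)) (lowerAt-other E 1+n≢n))
    pickJ (suc e) EJ≡2+e = coeff-absent n F (lowerAt J E) J<n J∉F λ retired →
      1+n≢0 (≡-trans (sym (cong (_∸ 1) EJ≡2+e)) (≡-trans (sym (lowerAt-same J E)) retired))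

coeff-fanEdges : ∀ n m {J} → 0 < J → FanCoeffFormula n J m
coeff-fanEdges n zero {J} 0<J D bound supp =
  cong₂ _-_
    (cong (whenPositive (D 0))
          (≡-trans (single 0) (cong₂ coeffOne (lowerAt-same 0 D) (lowerAt-other D (>⇒≢ 0<J)))))
    (cong (whenPositive (D J))
          (≡-trans (single J) (cong₂ coeffOne (lowerAt-other D (<⇒≢ 0<J)) (lowerAt-same J D))))
  where
  single : ∀ c → coeff n [] (lowerAt c D) ≡ coeffOne (lowerAt c D 0) (lowerAt c D J)
  single c = coeff-[]-pair n (lowerAt c D) 0<J (subst (_< n) (+-identityʳ J) bound)
               (SupportedOn-lowerAt c (subst (λ K → SupportedOn n J K D) (+-identityʳ J) supp))
coeff-fanEdges n (suc m) {J} 0<J D bound supp =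
  cong₂ _-_
    (cong (whenPositive (D 0))
          (≡-trans (afterSpoke 0 z<s)
                   (cong₂ (pathCoeff (D (suc J)) cs) (lowerAt-same 0 D) (lowerAt-other D (>⇒≢ 0<J)))))
    (cong (whenPositive (D J))
          (≡-trans (afterSpoke J (n<1+n J))
                   (cong₂ (pathCoeff (D (suc J)) cs) (lowerAt-other D (<⇒≢ 0<J)) (lowerAt-same J D))))
  where
  cs : List ℕ
  cs = map D (range (2 + J) m)

  afterSpoke : ∀ c → c < suc J →
    coeff n ((J , suc J) ∷ fanEdges (suc J) m) (lowerAt c D)
      ≡ pathCoeff (D (suc J)) cs (lowerAt c D 0) (lowerAt c D J)
  afterSpoke c c<1+J = begin
    coeff n ((J , suc J) ∷ fanEdges (suc J) m) (lowerAt c D)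
      ≡⟨ coeff-pathEdge 0<J (coeff-fanEdges n m z<s) (lowerAt c D)
           (subst (_< n) (+-suc J m) bound)
           (SupportedOn-lowerAt c (subst (λ K → SupportedOn n J K D) (+-suc J m) supp)) ⟩
    pathCoeff (lowerAt c D (suc J)) (map (lowerAt c D) (range (2 + J) m)) (lowerAt c D 0) (lowerAt c D J)
      ≡⟨ cong₂ (λ d ds → pathCoeff d ds (lowerAt c D 0) (lowerAt c D J))
               (lowerAt-other D (>⇒≢ c<1+J)) (map-lowerAt-range D (2 + J) m (m<n⇒m<1+n c<1+J)) ⟩
    pathCoeff (D (suc J)) cs (lowerAt c D 0) (lowerAt c D J) ∎
    where open ≡-Reasoning

-- The graph is a fan

fanCell : ℕ → ℕ → List (ℕ × ℕ)
fanCell i j = if (i <ᵇ j) ∧ ((i ≡ᵇ 0) ∨ (suc i ≡ᵇ j)) then (i , j) ∷ [] else []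

fanRow : ℕ → ℕ → List (ℕ × ℕ)
fanRow n i = concatMap (fanCell i) (range 0 n)

pathEdge : ℕ → ℕ × ℕ
pathEdge i = i , suc i

concatMap-fanCell-hub : ∀ a m → concatMap (fanCell 0) (range (suc a) m) ≡ map (0 ,_) (range (suc a) m)
concatMap-fanCell-hub a zero    = refl
concatMap-fanCell-hub a (suc m) = cong ((0 , suc a) ∷_) (concatMap-fanCell-hub (suc a) m)

fanCell-off : ∀ i x → x ≢ 2 + i → fanCell (suc i) x ≡ []
fanCell-off i x x≢2+i with suc i <ᵇ x
... | false = refl
... | true rewrite ≢⇒≡ᵇ≡false (x≢2+i ∘ sym) = refl

fanCell-on : ∀ i → fanCell (suc i) (2 + i) ≡ pathEdge (suc i) ∷ []
fanCell-on i rewrite Equivalence.to T-≡ (<⇒<ᵇ (n<1+n (suc i))) | ≡ᵇ-refl i = refl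

fanRow-path : ∀ n a m → n ≡ 2 + a + m →
  concatMap (fanRow n) (range (suc a) (suc m)) ≡ map pathEdge (range (suc a) m)
fanRow-path n a zero refl =
  ≡-trans (++-identityʳ _)
          (concatMap-range-outside 0 n (fanCell-off a) (inj₂ (≤-reflexive (+-identityʳ (2 + a)))))
fanRow-path n a (suc m) refl =
  cong₂ _++_ (≡-trans (concatMap-range-inside 0 n (fanCell-off a) z≤n (s≤s (s≤s (m<m+n a z<s))))
                      (fanCell-on a))
             (fanRow-path n (suc a) m (cong (2 +_) (+-suc a m)))

fanRows-spokes-path : ∀ M → concatMap (fanRow (2 + M)) (range 0 (2 + M))
                             ≡ map (0 ,_) (range 1 (suc M)) ++ map pathEdge (range 1 M)
fanRows-spokes-path M = cong₂ _++_ (concatMap-fanCell-hub 0 (suc M)) (fanRow-path (2 + M) 0 M refl)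

spokes++path↭fanEdges : ∀ m a → map (0 ,_) (range a (suc m)) ++ map pathEdge (range a m) ↭ fanEdges a m
spokes++path↭fanEdges zero    a = refl
spokes++path↭fanEdges (suc m) a =
  prep (0 , a) (trans (shift (pathEdge a) (map (0 ,_) (range (suc a) (suc m))) (map pathEdge (range (suc a) m)))
                      (prep (pathEdge a) (spokes++path↭fanEdges m (suc a))))


-- Since u is adjacent to every vertex, any chord ij between path vertices would cross the
-- chord from u to the successor of i; so only spokes and outer-cycle edges remain.
module _ {n} {G : Graph n} (ont : OuterplanarNearTriangulation G)
         (hub : ∀ x y → toℕ x ≡ 0 → (G x y ≡ true ⇔ toℕ y ≢ 0)) where
  open OuterplanarNearTriangulation ont

  fan-adjacency : ∀ i j → toℕ i < toℕ j → G i j ≡ ((toℕ i ≡ᵇ 0) ∨ (suc (toℕ i) ≡ᵇ toℕ j))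
  fan-adjacency i j i<j with toℕ i ≟ 0
  ... | yes i≡0 rewrite i≡0 = Equivalence.from (hub i j i≡0) (λ j≡0 → n≮0 (subst (0 <_) j≡0 i<j))
  ... | no i≢0 with toℕ j ≟ suc (toℕ i)
  ...   | yes j≡1+i rewrite ≢⇒≡ᵇ≡false i≢0 | j≡1+i | ≡ᵇ-refl (toℕ i) = cycleEdge i j j≡1+i
  ...   | no j≢1+i rewrite ≢⇒≡ᵇ≡false i≢0 | ≢⇒≡ᵇ≡false (j≢1+i ∘ sym) =
    noncrossing u i c j u<i i<c c<j u~c
    where
    1+i<j : suc (toℕ i) < toℕ j
    1+i<j = ≤∧≢⇒< i<j (j≢1+i ∘ sym)
    1+i<n : suc (toℕ i) < n
    1+i<n = <-trans 1+i<j (toℕ<n j)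
    u c : Fin n
    u = fromℕ< (<-trans z<s 1+i<n)
    c = fromℕ< 1+i<n
    u<i : toℕ u < toℕ i
    u<i rewrite toℕ-fromℕ< (<-trans z<s 1+i<n) = n≢0⇒n>0 i≢0
    i<c : toℕ i < toℕ c
    i<c rewrite toℕ-fromℕ< 1+i<n = n<1+n (toℕ i)
    c<j : toℕ c < toℕ j
    c<j rewrite toℕ-fromℕ< 1+i<n = 1+i<j
    u~c : G u c ≡ true
    u~c = Equivalence.from (hub u c (toℕ-fromℕ< _))
                           (λ c≡0 → 1+n≢0 (≡-trans (sym (toℕ-fromℕ< 1+i<n)) c≡0))

  edgeCell : Fin n → Fin n → List (Fin n × Fin n)
  edgeCell i j = if (toℕ i <ᵇ toℕ j) ∧ G i j then (i , j) ∷ [] else []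

  map-edgeCell : ∀ i j → map toℕ² (edgeCell i j) ≡ fanCell (toℕ i) (toℕ j)
  map-edgeCell i j with toℕ i <ᵇ toℕ j in i<ᵇj
  ... | false = refl
  ... | true rewrite fan-adjacency i j (<ᵇ⇒< _ _ (subst T (sym i<ᵇj) tt))
    with (toℕ i ≡ᵇ 0) ∨ (suc (toℕ i) ≡ᵇ toℕ j)
  ...   | true  = refl
  ...   | false = refl

  map-edges : map toℕ² (edges G) ≡ concatMap (fanRow n) (range 0 n)
  map-edges = map-concatMap-allFin toℕ² (λ i → concatMap (edgeCell i) (allFin n)) (fanRow n)
                (λ i → map-concatMap-allFin toℕ² (edgeCell i) (fanCell (toℕ i)) (map-edgeCell i))

coeffP-fan : ∀ M {G : Graph (2 + M)} → OuterplanarNearTriangulation G →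
  (∀ x y → toℕ x ≡ 0 → (G x y ≡ true ⇔ toℕ y ≢ 0)) →
  ∀ D → coeffP G (D ∘ toℕ) ≡ fanCoeff (map D (range 2 M)) (D 0) (D 1)
coeffP-fan M {G} ont hub D = begin
  coeffP G (D ∘ toℕ)
    ≡⟨ coeffProd≡coeff (edges G) D ⟩
  coeff (2 + M) (map toℕ² (edges G)) D
    ≡⟨ cong (λ es → coeff (2 + M) es D) (≡-trans (map-edges ont hub) (fanRows-spokes-path M)) ⟩
  coeff (2 + M) (map (0 ,_) (range 1 (suc M)) ++ map pathEdge (range 1 M)) D
    ≡⟨ coeff-↭ (2 + M) (spokes++path↭fanEdges M 1) D ⟩
  coeff (2 + M) (fanEdges 1 M) D
    ≡⟨ coeff-fanEdges (2 + M) M z<s D ≤-refl onlyHubAndPath ⟩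
  fanCoeff (map D (range 2 M)) (D 0) (D 1) ∎
  where
  open ≡-Reasoning
  onlyHubAndPath : SupportedOn (2 + M) 1 (1 + M) D
  onlyHubAndPath (suc x) x<n 0<x (inj₁ (s≤s ()))
  onlyHubAndPath x x<n 0<x (inj₂ 1+M<x) = ⊥-elim (<-irrefl refl (<-≤-trans 1+M<x (≤-pred x<n)))

-- The η and η_l exponent patterns

-- The exponents of v_2, …, v_{2k−1} in the η- and η_l-monomials, where l = p + 2 and
-- t counts the twos between v_l and v_{2k−1}.
etaPath : ℕ → List ℕ
etaPath t = replicate t 2 ++ 0 ∷ []

etaLPath : ℕ → ℕ → List ℕ
etaLPath p t = replicate p 2 ++ 1 ∷ etaPath t

fanCoeff-etaPath : ∀ t →
  fanCoeff (etaPath t) 1 2 ≡ (if odd t then 1ℤ else -1ℤ) ×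
  fanCoeff (etaPath t) 2 1 ≡ (if odd t then 0ℤ else 1ℤ) ×
  fanCoeff (etaPath t) 3 0 ≡ (if odd t then -1ℤ else 0ℤ)
fanCoeff-etaPath zero = refl , refl , refl
fanCoeff-etaPath (suc t) with fanCoeff-etaPath t
... | e₁ , e₂ , _ rewrite e₁ | e₂ with odd t
... | true  = refl , refl , refl
... | false = refl , refl , refl

fanCoeff-etaLPath : ∀ q t →
  fanCoeff (etaLPath q t) 2 2 ≡ (if odd t then 0ℤ else if odd q then 1ℤ else -1ℤ) ×
  fanCoeff (etaLPath q t) 3 1 ≡ (if odd t then -1ℤ else if odd q then 0ℤ else 1ℤ)
fanCoeff-etaLPath zero t with fanCoeff-etaPath t
... | _ , e₂ , e₃ rewrite e₂ | e₃ with odd t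
... | true  = refl , refl
... | false = refl , refl
fanCoeff-etaLPath (suc q) t with fanCoeff-etaLPath q t
... | e₁ , e₂ rewrite e₁ | e₂ with odd t | odd q
... | true  | _     = refl , refl
... | false | true  = refl , refl
... | false | false = refl , refl

fanCoeff-etaLPath-4-0 : ∀ p t → odd p ≡ odd t →
  fanCoeff (etaLPath p t) 4 0 ≡ (if odd t then 1ℤ else 0ℤ)
fanCoeff-etaLPath-4-0 zero t _ with fanCoeff-etaPath t
... | _ , _ , e₃ rewrite e₃ with odd t
... | true  = refl
... | false = refl
fanCoeff-etaLPath-4-0 (suc q) t parity with fanCoeff-etaLPath q t
... | _ , e₂ rewrite e₂ | sym parity with odd q
... | true  = refl
... | false = refl

map-range-etaPath : ∀ (f : Exponents) a t → (∀ x → a ≤ x → x < a + t → f x ≡ 2) → f (a + t) ≡ 0 →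
  map f (range a (suc t)) ≡ etaPath t
map-range-etaPath f a zero    twos last = cong (_∷ []) (≡-trans (cong f (sym (+-identityʳ a))) last)
map-range-etaPath f a (suc t) twos last =
  cong₂ _∷_ (twos a ≤-refl (m<m+n a z<s))
            (map-range-etaPath f (suc a) t
              (λ x a<x x<1+a+t → twos x (<⇒≤ a<x) (subst (x <_) (sym (+-suc a t)) x<1+a+t))
              (≡-trans (cong f (sym (+-suc a t))) last))

map-range-etaLPath : ∀ (f : Exponents) a p t →
  (∀ x → a ≤ x → x < a + p → f x ≡ 2) → f (a + p) ≡ 1 →
  (∀ x → a + p < x → x < suc (a + p + t) → f x ≡ 2) → f (suc (a + p + t)) ≡ 0 →
  map f (range a (2 + p + t)) ≡ etaLPath p t
map-range-etaLPath f a zero t _ one twos last rewrite +-identityʳ a =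
  cong₂ _∷_ one (map-range-etaPath f (suc a) t (λ x a<x → twos x a<x) last)
map-range-etaLPath f a (suc p) t twos one twos′ last =
  cong₂ _∷_ (twos a ≤-refl (m<m+n a z<s))
            (map-range-etaLPath f (suc a) p t
              (λ x a<x x<1+a+p → twos x (<⇒≤ a<x) (subst (x <_) (sym (+-suc a p)) x<1+a+p))
              (≡-trans (cong f (sym (+-suc a p))) one)
              (λ x → subst (λ b → b < x → x < suc (b + t) → f x ≡ 2) (+-suc a p) (twos′ x))
              (subst (λ b → f (suc (b + t)) ≡ 0) (+-suc a p) last))

-- etaMono k and etaLMono k l are definitionally etaExps k ∘ toℕ and etaLExps k l ∘ toℕ.
etaExps : ℕ → Exponents
etaExps k y = if y ≡ᵇ 0 then 3 else if (y ≡ᵇ 1) ∨ (y ≡ᵇ (2 * k ∸ 1)) then 0 else 2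

etaLExps : ℕ → ℕ → Exponents
etaLExps k l y = if y ≡ᵇ 0 then 4
  else if (y ≡ᵇ 1) ∨ (y ≡ᵇ (2 * k ∸ 1)) then 0
  else if y ≡ᵇ l then 1 else 2

etaExps-inner : ∀ k x → 2 ≤ x → x ≢ 2 * k ∸ 1 → etaExps k x ≡ 2
etaExps-inner k (suc (suc x)) (s≤s (s≤s _)) x≢last rewrite ≢⇒≡ᵇ≡false x≢last = refl

etaExps-last : ∀ k → 2 ≤ 2 * k ∸ 1 → etaExps k (2 * k ∸ 1) ≡ 0
etaExps-last k 2≤last
  rewrite ≢⇒≡ᵇ≡false (>⇒≢ (<-trans z<s 2≤last)) | ≢⇒≡ᵇ≡false (>⇒≢ 2≤last) | ≡ᵇ-refl (2 * k ∸ 1) = refl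

etaLExps-inner : ∀ k l x → 2 ≤ x → x ≢ 2 * k ∸ 1 → x ≢ l → etaLExps k l x ≡ 2
etaLExps-inner k l (suc (suc x)) (s≤s (s≤s _)) x≢last x≢l
  rewrite ≢⇒≡ᵇ≡false x≢last | ≢⇒≡ᵇ≡false x≢l = refl

etaLExps-at : ∀ k l → 2 ≤ l → l ≢ 2 * k ∸ 1 → etaLExps k l l ≡ 1
etaLExps-at k (suc (suc l)) (s≤s (s≤s _)) l≢last rewrite ≢⇒≡ᵇ≡false l≢last | ≡ᵇ-refl l = refl

etaLExps-last : ∀ k l → 2 ≤ 2 * k ∸ 1 → etaLExps k l (2 * k ∸ 1) ≡ 0
etaLExps-last k l 2≤last
  rewrite ≢⇒≡ᵇ≡false (>⇒≢ (<-trans z<s 2≤last)) | ≢⇒≡ᵇ≡false (>⇒≢ 2≤last) | ≡ᵇ-refl (2 * k ∸ 1) = refl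

module _ (κ : ℕ) {G : Graph (2 * (2 + κ))} (ont : OuterplanarNearTriangulation G)
         (hub : ∀ x y → toℕ x ≡ 0 → (G x y ≡ true ⇔ toℕ y ≢ 0)) where
  private
    k M : ℕ
    k = 2 + κ
    M = 2 * k ∸ 2

    odd-M : odd M ≡ false
    odd-M = ≡-trans (cong odd (sym (*-distribˡ-∸ 2 k 1))) (odd-2* (suc κ))

  coeffP-eta : coeffP G (etaMono k) ≡ -1ℤ
  coeffP-eta = begin
    coeffP G (etaMono k)                         ≡⟨ coeffP-fan M ont hub (etaExps k) ⟩
    fanCoeff (map (etaExps k) (range 2 M)) 3 0   ≡⟨ cong (λ ds → fanCoeff ds 3 0) path ⟩
    fanCoeff (etaPath t) 3 0                     ≡⟨ proj₂ (proj₂ (fanCoeff-etaPath t)) ⟩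
    (if odd t then -1ℤ else 0ℤ)                  ≡⟨ cong (if_then -1ℤ else 0ℤ) odd-t ⟩
    -1ℤ                                          ∎
    where
    open ≡-Reasoning
    t : ℕ
    t = κ + suc (κ + 0)
    M≡1+t : M ≡ suc t
    M≡1+t = +-suc κ (suc (κ + 0))
    odd-t : odd t ≡ true
    odd-t = not-injective (≡-trans (sym (cong odd M≡1+t)) odd-M)
    path : map (etaExps k) (range 2 M) ≡ etaPath t
    path = ≡-trans (cong (λ m → map (etaExps k) (range 2 m)) M≡1+t)
      (map-range-etaPath (etaExps k) 2 t
        (λ x 2≤x x<2+t → etaExps-inner k x 2≤x
           (λ x≡last → <-irrefl (≡-trans x≡last (cong suc M≡1+t)) x<2+t))
        (subst (λ y → etaExps k y ≡ 0) (cong suc M≡1+t)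
               (etaExps-last k (subst (λ m → 2 ≤ suc m) (sym M≡1+t) (s≤s (s≤s z≤n))))))

  coeffP-etaL : ∀ l → 2 ≤ l → l ≤ M → coeffP G (etaLMono k l) ≡ (if odd l then 1ℤ else 0ℤ)
  coeffP-etaL l@(suc (suc p)) 2≤l@(s≤s (s≤s _)) l≤M = begin
    coeffP G (etaLMono k l)                          ≡⟨ coeffP-fan M ont hub (etaLExps k l) ⟩
    fanCoeff (map (etaLExps k l) (range 2 M)) 4 0    ≡⟨ cong (λ ds → fanCoeff ds 4 0) path ⟩
    fanCoeff (etaLPath p t) 4 0                      ≡⟨ fanCoeff-etaLPath-4-0 p t odd-p≡odd-t ⟩
    (if odd t then 1ℤ else 0ℤ)                       ≡⟨ cong (if_then 1ℤ else 0ℤ) odd-l≡odd-t ⟨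
    (if odd l then 1ℤ else 0ℤ)                       ∎
    where
    open ≡-Reasoning
    t : ℕ
    t = M ∸ l
    M≡l+t : M ≡ l + t
    M≡l+t = sym (m+[n∸m]≡n l≤M)
    odd-l≡odd-t : odd l ≡ odd t
    odd-l≡odd-t = xor≡false⇒≡ (≡-trans (sym (odd-+ l t)) (≡-trans (cong odd (sym M≡l+t)) odd-M))
    odd-p≡odd-t : odd p ≡ odd t
    odd-p≡odd-t = ≡-trans (sym (not-involutive (odd p))) odd-l≡odd-t
    l<last : l < suc M
    l<last = s≤s l≤M
    path : map (etaLExps k l) (range 2 M) ≡ etaLPath p t
    path = ≡-trans (cong (λ m → map (etaLExps k l) (range 2 m)) M≡l+t)
      (map-range-etaLPath (etaLExps k l) 2 p t
        (λ x 2≤x x<l → etaLExps-inner k l x 2≤x (<⇒≢ (<-trans x<l l<last)) (<⇒≢ x<l))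
        (etaLExps-at k l 2≤l (<⇒≢ l<last))
        (λ x l<x x<1+l+t → etaLExps-inner k l x (≤-trans 2≤l (<⇒≤ l<x))
           (λ x≡last → <-irrefl (≡-trans x≡last (cong suc M≡l+t)) x<1+l+t) (>⇒≢ l<x))
        (subst (λ y → etaLExps k l y ≡ 0) (cong suc M≡l+t)
               (etaLExps-last k l (s≤s (≤-trans (s≤s z≤n) l≤M)))))

lemma4p9 : (k : ℕ) → 1 < k → (G : Graph (2 * k)) →
    TwoConnected G → OuterplanarNearTriangulation G →
    (∀ x y → toℕ x ≡ 0 → (G x y ≡ true ⇔ toℕ y ≢ 0)) →
    (∀ x → toℕ x ≡ 1 → degree G x ≡ 2) →
    (∀ x → suc (toℕ x) ≡ 2 * k → degree G x ≡ 2) →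
    (∣ coeffP G (etaMono k) ∣ ≡ 1) ×
    (∀ l → 2 ≤ l → l ≤ 2 * k ∸ 2 →
      ((∃[ j ] l ≡ 2 * j + 1) → ∣ coeffP G (etaLMono k l) ∣ ≡ 1) ×
      ((∃[ j ] l ≡ 2 * j) → coeffP G (etaLMono k l) ≡ ℤ+ 0))
lemma4p9 (suc (suc κ)) (s≤s (s≤s _)) G _ ont hub _ _ =
  cong ∣_∣ (coeffP-eta κ ont hub) , λ l 2≤l l≤M →
    (λ (j , l≡2j+1) → cong ∣_∣ (≡-trans (coeffP-etaL κ ont hub l 2≤l l≤M)
                                 (cong (if_then 1ℤ else 0ℤ) (≡-trans (cong odd l≡2j+1) (odd-2*+1 j))))) ,
    (λ (j , l≡2j) → ≡-trans (coeffP-etaL κ ont hub l 2≤l l≤M)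
                           (cong (if_then 1ℤ else 0ℤ) (≡-trans (cong odd l≡2j) (odd-2* j))))
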